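{- Let $\mathcal{P}$ be a client/server system, $s$ a global state of $\mathrm{TS}(\mathcal{P})$ and $b\in\mathit{enabled}(s)$. Then $\mathit{p\text{ - }set}(s,b)$ is a persistent set in $s$, i.e. for every run $s\xrightarrow{b_1\dots b_n}t$ of $\mathrm{TS}(\mathcal{P})$, if $b_i\notin\mathit{p\text{ - }set}(s,b)$ for all $i$, then every $b_i$ is independent of every action in $\mathit{p\text{ - }set}(s,b)$.
   Context: A client/server system $\mathcal{P}$: a finite set of processes $\mathit{Proc}=\mathit{Clients}\cup\mathit{Servers}$ (disjoint), each $p$ with a finite action-deterministic transition system $\mathrm{TS}_p$ over actions $\Sigma_p$, clients' systems acyclic; $\mathit{dom}(a)=\{p:a\in\Sigma_p\}$ consists of exactly one client and one server. $\mathrm{TS}(\mathcal{P})$: global states are tuples $(s_p)_p$, $s\xrightarrow{a}s'$ iff $s_p\xrightarrow{a}s'_p$ in $\mathrm{TS}_p$ for $p\in\mathit{dom}(a)$ and $s'_p=s_p$ otherwise. $\xrightarrow{}^*_p$ denotes a (possibly empty) path in $\mathrm{TS}_p$ and $s_p\xrightarrow{c}_p$ means $s_p$ has an outgoing $c$-transition. $\mathit{enabled}(s)$ is the set of labels of transitions leaving $s$ in $\mathrm{TS}(\mathcal{P})$. Actions $a,c$ are independent if $\mathit{dom}(a)\cap\mathit{dom}(c)=\emptyset$. $\mathit{p\text{ - }closure}(s,b)$ is the smallest set of processes $R$ such that $\mathit{dom}(b)\subseteq R$, and if $p\in R$ and $s_p\xrightarrow{}^*_p\xrightarrow{c}_p$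 then $\mathit{dom}(c)\subseteq R$. Then $\mathit{p\text{ - }set}(s,b)=\{a\in\mathit{enabled}(s):\mathit{dom}(a)\subseteq\mathit{p\text{ - }closure}(s,b)\}$. -}

module Defs where

open import Data.Nat using (ℕ)
open import Data.Fin using (Fin)
open import Data.Bool using (Bool; true; false)
open import Data.Maybe using (Maybe; just; nothing)
open import Data.List using (List; []; _∷_)
open import Data.List.Relation.Unary.All using (All)
open import Data.Product using (Σ; ∃; _×_; _,_)
open import Data.Sum using (_⊎_)
open import Data.Empty using (⊥)
open import Relation.Nullary using (¬_)
open import Relation.Binary.PropositionalEquality using (_≡_; _≢_)

module _ {St Act : Set} (δ : St → Act → Maybe St) where

  data Path : St → St → Set where
    path-nil  : ∀ {r} → Path r r
    path-cons : ∀ {r r' r'' a} → δ r a ≡ just r' → Path r' r'' → Path r r''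

  data Path⁺ : St → St → Set where
    path⁺ : ∀ {r r' r'' a} → δ r a ≡ just r' → Path r' r'' → Path⁺ r r''

-- Processes are Fin nProc; isClient p ≡ true means p ∈ Clients, otherwise
-- p ∈ Servers (so Clients and Servers are disjoint and cover Proc).
-- Actions are drawn from the finite universe Fin nAct; Σₚ p a ≡ true means a ∈ Σ_p.
-- TS_p has the finite state set Fin (nSt p) and an action-deterministic
-- transition function δ p (δ p r a ≡ just r' iff r --a--> r' in TS_p).
record CSSystem : Set₁ where
  field
    nProc    : ℕ
    isClient : Fin nProc → Bool
    nAct     : ℕ
    Σₚ       : Fin nProc → Fin nAct → Bool
    nSt      : Fin nProc → ℕ
    δ        : (p : Fin nProc) → Fin (nSt p) → Fin nAct → Maybe (Fin (nSt p))
    δ-label  : ∀ p r a r' → δ p r a ≡ just r' → Σₚ p a ≡ true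
    dom-cs   : ∀ a → Σ (Fin nProc) λ c → Σ (Fin nProc) λ d →
                 isClient c ≡ true × isClient d ≡ false ×
                 (∀ p → Σₚ p a ≡ true → p ≡ c ⊎ p ≡ d) ×
                 Σₚ c a ≡ true × Σₚ d a ≡ true
    clients-acyclic : ∀ p → isClient p ≡ true → ∀ r → ¬ Path⁺ (δ p) r r

module CS (P : CSSystem) where
  open CSSystem P

  Proc : Set
  Proc = Fin nProc

  Act : Set
  Act = Fin nAct

  InDom : Act → Proc → Set
  InDom a p = Σₚ p a ≡ true

  GState : Set
  GState = (p : Proc) → Fin (nSt p)

  GStep : GState → Act → GState → Set
  GStep s a s' = (∀ p → InDom a p → δ p (s p) a ≡ just (s' p))
               × (∀ p → ¬ InDom a p → s' p ≡ s p)

  Enabled : GState → Act → Set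
  Enabled s a = ∃ λ s' → GStep s a s'

  data Run : GState → List Act → GState → Set where
    run-nil  : ∀ {s} → Run s [] s
    run-cons : ∀ {s s' t a as} → GStep s a s' → Run s' as t → Run s (a ∷ as) t

  Independent : Act → Act → Set
  Independent a c = ∀ p → InDom a p → InDom c p → ⊥

  data PClosure (s : GState) (b : Act) : Proc → Set where
    pc-base : ∀ {p} → InDom b p → PClosure s b p
    pc-step : ∀ {p q r c} → PClosure s b p → Path (δ p) (s p) r →
              δ p r c ≢ nothing → InDom c q → PClosure s b q

  PSet : GState → Act → Act → Set
  PSet s b a = Enabled s a × (∀ p → InDom a p → PClosure s b p)

  Persistent : GState → (Act → Set) → Set
  Persistent s T = ∀ bs t → Run s bs t → All (λ bi → ¬ T bi) bs →
                   All (λ bi → ∀ a → T a → Independent bi a) bs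

{-# OPTIONS --safe #-}
module Submission where

-- The processes of p-closure(s,b) never move along a run that avoids
-- p-set(s,b): the first action c touching such a process p would be enabled in
-- the local state s_p, so dom(c) lies in the closure; all of dom(c) being still
-- in its s-state, c would be enabled in s itself and hence belong to p-set(s,b).
-- Only this one-step closure property of p-closure(s,b) is needed.

open import Defs
open import Data.Bool using (true; false; if_then_else_)
open import Data.Bool.Properties using (not-¬)
open import Data.Maybe using (just; nothing)
open import Data.List.Relation.Unary.All using (All; []; _∷_)
open import Data.Product using (_×_; _,_; proj₁; proj₂)
open import Relation.Nullary using (¬_; contradiction)
open import Relation.Binary.PropositionalEquality
  using (_≡_; _≢_; refl; sym; trans; subst)

module _ (P : CSSystem) where
  open CSSystem P
  open CS P

  AgreesOn : (Proc → Set) → GState → GState → Set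
  AgreesOn R t s = ∀ p → R p → t p ≡ s p

  Confined : (Proc → Set) → Act → Set
  Confined R a = ∀ p → InDom a p → R p

  ClosedUnderEnabled : GState → (Proc → Set) → Set
  ClosedUnderEnabled s R =
    ∀ {p q c} → R p → δ p (s p) c ≢ nothing → InDom c q → R q

  module _ {s t t' : GState} {c : Act} (step : GStep t c t') where

    local-step-from : ∀ {p} → InDom c p → t p ≡ s p → δ p (s p) c ≡ just (t' p)
    local-step-from {p} p∈c tₚ≡sₚ =
      subst (λ r → δ p r c ≡ just (t' p)) tₚ≡sₚ (proj₁ step p p∈c)

    enabled-transfer : AgreesOn (InDom c) t s → Enabled s c
    enabled-transfer t≈s = s' , local , frame
      where
      s' : GState
      s' q = if Σₚ q c then t' q else s q

      local : ∀ q → InDom c q → δ q (s q) c ≡ just (s' q)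
      local q q∈c rewrite q∈c = local-step-from q∈c (t≈s q q∈c)

      frame : ∀ q → ¬ InDom c q → s' q ≡ s q
      frame q q∉c with Σₚ q c
      ... | true  = contradiction refl q∉c
      ... | false = refl

    module _ {R : Proc → Set} (closed : ClosedUnderEnabled s R)
             (t≈s : AgreesOn R t s) where

      touching⇒confined : ∀ {p} → InDom c p → R p → Confined R c
      touching⇒confined {p} p∈c p∈R q q∈c = closed p∈R enabled-at-sₚ q∈c
        where
        enabled-at-sₚ : δ p (s p) c ≢ nothing
        enabled-at-sₚ δ≡nothing =
          contradiction (trans (sym (local-step-from p∈c (t≈s p p∈R))) δ≡nothing) λ ()

      outside⇒avoids : ¬ (Enabled s c × Confined R c) → ∀ p → InDom c p → ¬ R p
      outside⇒avoids c∉T p p∈c p∈R =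
        c∉T (enabled-transfer (λ q q∈c → t≈s q (c⊆R q q∈c)) , c⊆R)
        where
        c⊆R : Confined R c
        c⊆R = touching⇒confined p∈c p∈R

      outside⇒agreesOn : ¬ (Enabled s c × Confined R c) → AgreesOn R t' s
      outside⇒agreesOn c∉T p p∈R with Σₚ p c in p∈c?
      ... | true  = contradiction p∈R (outside⇒avoids c∉T p p∈c?)
      ... | false = trans (proj₂ step p (not-¬ p∈c?)) (t≈s p p∈R)

  confined-enabled-persistent : ∀ {s R} → ClosedUnderEnabled s R →
    Persistent s (λ a → Enabled s a × Confined R a)
  confined-enabled-persistent {s} {R} closed _ u = go (λ _ _ → refl)
    where
    T : Act → Set
    T a = Enabled s a × Confined R a

    go : ∀ {t bs} → AgreesOn R t s → Run t bs u → All (λ bi → ¬ T bi) bs →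
         All (λ bi → ∀ a → T a → Independent bi a) bs
    go t≈s run-nil [] = []
    go t≈s (run-cons step run) (c∉T ∷ cs∉T) =
      (λ _ (_ , a⊆R) p p∈c p∈a →
         outside⇒avoids step closed t≈s c∉T p p∈c (a⊆R p p∈a))
      ∷ go (outside⇒agreesOn step closed t≈s c∉T) run cs∉T

  pclosure-closedUnderEnabled : ∀ s b → ClosedUnderEnabled s (PClosure s b)
  pclosure-closedUnderEnabled s b p∈R enabled q∈c = pc-step p∈R path-nil enabled q∈c

lemma10p4 : (P : CSSystem) → let open CS P in
    (s : GState) (b : Act) → Enabled s b → Persistent s (PSet s b)
lemma10p4 P s b _ =
  confined-enabled-persistent P (pclosure-closedUnderEnabled P s b)
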